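{- Let $G=(V,E)$ be a directed graph with nonnegative edge capacities $c$, let $r\in V$, let $T\subseteq V\setminus\{r\}$ be a set of terminals, and let $\lambda>0$. Let $(A,B\cup\{t^\star\})$ be a minimum $(r,t^\star)$-cut in the $(\lambda,T)$-flow problem, where $r\in A$ and $A\cup B=V$ is a partition. Then: (1) for every $t\in T\cap A$, the $(r,t)$-edge connectivity of $G$ is at least $\lambda$; (2) for every $t\in T\cap B$, there is a minimum $(r,t)$-edge cut of $G$ whose sink component is contained in $B$.
   Context: For $S\subseteq V$, $\partial^-(S)$ is the set of arcs entering $S$ and $c(\partial^-(S))$ its total capacity. The $(r,t)$-edge connectivity is the minimum of $c(\partial^-(S))$ over $S\subseteq V\setminus\{r\}$ with $t\in S$; such a minimizer $\partial^-(S)$ is a minimum $(r,t)$-cut with sink component $S$. The $(\lambda,T)$-flow problem is the maximum flow problem with source $r$ and sink $t^\star$ on the network obtained from $G$ by adding a new vertex $t^\star$ and, for every $t\in T$, an arc $(t,t^\star)$ of capacity $\lambda$.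
   Formalization: The edge capacities $c$ and the parameter $\lambda$ take rational values. -}

module Defs where

open import Data.Nat using (ℕ; zero; suc; _+_)
open import Data.Fin using (Fin; zero; suc; fromℕ; inject₁; _↑ˡ_; _↑ʳ_; splitAt)
open import Data.Fin.Subset using (Subset; _∈_; _∉_; _⊆_; inside; outside)
open import Data.Fin.Subset.Properties using (_∈?_)
open import Data.Vec using (_∷ʳ_)
open import Data.Sum using (_⊎_; inj₁; inj₂)
open import Data.Product using (_×_)
open import Data.Rational using (ℚ; 0ℚ; _≤_) renaming (_+_ to _+ℚ_)
open import Relation.Nullary using (yes; no)

record Network (n : ℕ) : Set where
  field
    m    : ℕ
    tail : Fin m → Fin n
    head : Fin m → Fin n
    cap  : Fin m → ℚ
open Network public

sumFin : (k : ℕ) → (Fin k → ℚ) → ℚ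
sumFin zero    f = 0ℚ
sumFin (suc k) f = f zero +ℚ sumFin k (λ i → f (suc i))

entering : ∀ {n} (N : Network n) (S : Subset n) → Fin (m N) → ℚ
entering N S e with head N e ∈? S | tail N e ∈? S
... | yes _ | no _ = cap N e
... | _     | _    = 0ℚ

cutIn : ∀ {n} (N : Network n) (S : Subset n) → ℚ
cutIn N S = sumFin (m N) (entering N S)

IsCutSink : ∀ {n} (r t : Fin n) (S : Subset n) → Set
IsCutSink r t S = r ∉ S × t ∈ S

IsMinCut : ∀ {n} (N : Network n) (r t : Fin n) (S : Subset n) → Set
IsMinCut N r t S =
  IsCutSink r t S × (∀ S' → IsCutSink r t S' → cutIn N S ≤ cutIn N S')

ConnAtLeast : ∀ {n} (N : Network n) (r t : Fin n) (λ' : ℚ) → Set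
ConnAtLeast N r t λ' = ∀ S → IsCutSink r t S → λ' ≤ cutIn N S

-- The (λ,T)-flow network: vertex set V ∪ {t⋆} where V is embedded by
-- inject₁ and t⋆ = fromℕ n; arcs are those of G followed by one arc
-- (t, t⋆) of capacity λ for each t ∈ T.  For uniformity an arc (t,t⋆) is
-- present for every t : Fin n, with capacity 0 when t ∉ T (this does not
-- change any cut value).
tstar : (n : ℕ) → Fin (suc n)
tstar n = fromℕ n

lamCap : ∀ {n} (T : Subset n) (λ' : ℚ) → Fin n → ℚ
lamCap T λ' t with t ∈? T
... | yes _ = λ'
... | no  _ = 0ℚ

augTail : ∀ {n} (G : Network n) → Fin (m G) ⊎ Fin n → Fin (suc n)
augTail G (inj₁ e) = inject₁ (tail G e)
augTail G (inj₂ t) = inject₁ t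

augHead : ∀ {n} (G : Network n) → Fin (m G) ⊎ Fin n → Fin (suc n)
augHead G (inj₁ e) = inject₁ (head G e)
augHead {n} G (inj₂ t) = tstar n

augCap : ∀ {n} (G : Network n) (T : Subset n) (λ' : ℚ) → Fin (m G) ⊎ Fin n → ℚ
augCap G T λ' (inj₁ e) = cap G e
augCap G T λ' (inj₂ t) = lamCap T λ' t

flowNetwork : ∀ {n} (G : Network n) (T : Subset n) (λ' : ℚ) → Network (suc n)
flowNetwork {n} G T λ' = record
  { m    = m G + n
  ; tail = λ e → augTail G (splitAt (m G) e)
  ; head = λ e → augHead G (splitAt (m G) e)
  ; cap  = λ e → augCap G T λ' (splitAt (m G) e)
  }

withTstar : ∀ {n} → Subset n → Subset (suc n)
withTstar B = B ∷ʳ inside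

{-# OPTIONS --safe #-}
module Submission where

-- The flow cut with sink side B ∪ {t⋆} costs c(∂⁻B) + λ·|T ∖ B|, so B minimises
-- X ↦ c(∂⁻X) + λ·|T ∖ X| over all X ∌ r.  Compare B with S ∪ B for an (r,t)-cut sink S.
-- If t ∈ T ∩ S lies outside B, the terminal term drops by at least λ, and since
-- c(∂⁻(S ∪ B)) ≤ c(∂⁻S) + c(∂⁻B) this forces c(∂⁻S) ≥ λ.  In general the terminal term
-- does not grow, so c(∂⁻B) ≤ c(∂⁻(S ∪ B)); submodularity then gives
-- c(∂⁻(S ∩ B)) ≤ c(∂⁻S), so a minimum (r,t)-cut shrunk into B stays minimum.

open import Defs
open import Algebra.Bundles using (CommutativeMonoid)
open import Data.Bool using (Bool; true; false; _∧_; _∨_; if_then_else_)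
open import Data.Bool.Properties using (¬-not; ∨-comm)
import Data.Nat as ℕ
open import Data.Fin using (Fin; zero; suc; inject₁; _↑ˡ_; _↑ʳ_)
open import Data.Fin.Properties using (splitAt-↑ˡ; splitAt-↑ʳ)
open import Data.Fin.Subset using (Subset; _∈_; _∉_; _⊆_; _∪_; _∩_; inside; outside)
open import Data.Fin.Subset.Properties using (_∈?_; x∈p∩q⁺; x∈p∩q⁻; x∈p∪q⁻; p∩q⊆q)
open import Data.List using (List; []; _∷_; _++_; map; filter)
import Data.List.Membership.Propositional as List
open import Data.List.Membership.Propositional.Properties using (∈-++⁺ˡ; ∈-++⁺ʳ; ∈-map⁺; ∈-filter⁺)
import Data.List.Relation.Unary.All as All
open import Data.List.Relation.Unary.All.Properties using (all-filter)
open import Data.List.Relation.Unary.Any using (here)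
open import Data.Product using (Σ; _×_; _,_; proj₁)
open import Data.Rational using (ℚ; 0ℚ; _≤_; _<_; _+_; -_)
import Data.Rational.Properties as ℚ
open import Data.Sum using ([_,_])
open import Data.Vec using ([]; _∷_; lookup)
open import Data.Vec.Properties using (lookup-zipWith; []=⇒lookup; lookup⇒[]=)
open import Function using (_∘_)
open import Relation.Binary.Bundles using (DecTotalOrder)
open import Relation.Binary.PropositionalEquality using (_≡_; refl; sym; trans; cong; cong₂; subst; subst₂)
open import Relation.Nullary using (yes; no; contradiction)
open import Relation.Nullary.Decidable using (¬?; _×-dec_)
open import Relation.Unary using (Decidable)

open import Algebra.Properties.Group ℚ.+-0-group using (\\-leftDividesʳ)
open import Algebra.Properties.CommutativeSemigroup
  (CommutativeMonoid.commutativeSemigroup ℚ.+-0-commutativeMonoid) using (xy∙z≈xz∙y; xy∙z≈yz∙x; interchange)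
open import Data.List.Extrema (DecTotalOrder.totalOrder ℚ.≤-decTotalOrder)
  using (argmin; argmin-all; f[argmin]≤f[xs])
open ℚ.≤-Reasoning

+-cancelˡ-≤ : ∀ a {x y} → a + x ≤ a + y → x ≤ y
+-cancelˡ-≤ a {x} {y} = subst₂ _≤_ (\\-leftDividesʳ a x) (\\-leftDividesʳ a y) ∘ ℚ.+-monoʳ-≤ (- a)

+-cancelʳ-≤ : ∀ a {x y} → x + a ≤ y + a → x ≤ y
+-cancelʳ-≤ a {x} {y} = +-cancelˡ-≤ a ∘ subst₂ _≤_ (ℚ.+-comm x a) (ℚ.+-comm y a)

sumFin-cong : ∀ k {f g : Fin k → ℚ} → (∀ i → f i ≡ g i) → sumFin k f ≡ sumFin k g
sumFin-cong ℕ.zero    f≡g = refl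
sumFin-cong (ℕ.suc k) f≡g = cong₂ _+_ (f≡g zero) (sumFin-cong k (f≡g ∘ suc))

sumFin-mono : ∀ k {f g : Fin k → ℚ} → (∀ i → f i ≤ g i) → sumFin k f ≤ sumFin k g
sumFin-mono ℕ.zero    f≤g = ℚ.≤-refl
sumFin-mono (ℕ.suc k) f≤g = ℚ.+-mono-≤ (f≤g zero) (sumFin-mono k (f≤g ∘ suc))

sumFin-nonneg : ∀ k {f : Fin k → ℚ} → (∀ i → 0ℚ ≤ f i) → 0ℚ ≤ sumFin k f
sumFin-nonneg ℕ.zero    f≥0 = ℚ.≤-refl
sumFin-nonneg (ℕ.suc k) f≥0 = ℚ.+-mono-≤ (f≥0 zero) (sumFin-nonneg k (f≥0 ∘ suc))

sumFin-+ : ∀ k (f g : Fin k → ℚ) → sumFin k (λ i → f i + g i) ≡ sumFin k f + sumFin k g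
sumFin-+ ℕ.zero    f g = sym (ℚ.+-identityˡ 0ℚ)
sumFin-+ (ℕ.suc k) f g =
  trans (cong (f zero + g zero +_) (sumFin-+ k (f ∘ suc) (g ∘ suc)))
        (interchange (f zero) (g zero) (sumFin k (f ∘ suc)) (sumFin k (g ∘ suc)))

sumFin-↑ : ∀ a b (f : Fin (a ℕ.+ b) → ℚ) →
  sumFin (a ℕ.+ b) f ≡ sumFin a (λ i → f (i ↑ˡ b)) + sumFin b (λ i → f (a ↑ʳ i))
sumFin-↑ ℕ.zero    b f = sym (ℚ.+-identityˡ _)
sumFin-↑ (ℕ.suc a) b f = trans (cong (f zero +_) (sumFin-↑ a b (f ∘ suc))) (sym (ℚ.+-assoc (f zero) _ _))

sumFin-mono-gap : ∀ k {f g : Fin k → ℚ} d → (∀ i → f i ≤ g i) →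
  ∀ j → f j + d ≤ g j → sumFin k f + d ≤ sumFin k g
sumFin-mono-gap (ℕ.suc k) {f} {g} d f≤g zero gap = begin
  f zero + sumFin k (f ∘ suc) + d  ≡⟨ xy∙z≈xz∙y (f zero) _ d ⟩
  f zero + d + sumFin k (f ∘ suc)  ≤⟨ ℚ.+-mono-≤ gap (sumFin-mono k (f≤g ∘ suc)) ⟩
  g zero + sumFin k (g ∘ suc)      ∎
sumFin-mono-gap (ℕ.suc k) {f} {g} d f≤g (suc j) gap = begin
  f zero + sumFin k (f ∘ suc) + d    ≡⟨ ℚ.+-assoc (f zero) _ d ⟩
  f zero + (sumFin k (f ∘ suc) + d)  ≤⟨ ℚ.+-mono-≤ (f≤g zero) (sumFin-mono-gap k d (f≤g ∘ suc) j gap) ⟩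
  g zero + sumFin k (g ∘ suc)        ∎

arcValue : Bool → Bool → ℚ → ℚ
arcValue true  tailInside c = if tailInside then 0ℚ else c
arcValue false _          c = 0ℚ

arcValue-nonneg : ∀ {c} → 0ℚ ≤ c → ∀ h t → 0ℚ ≤ arcValue h t c
arcValue-nonneg c≥0 true  true  = ℚ.≤-refl
arcValue-nonneg c≥0 true  false = c≥0
arcValue-nonneg c≥0 false t     = ℚ.≤-refl

arcValue-∨ˡ : ∀ {c} → 0ℚ ≤ c → ∀ a t → arcValue true (a ∨ t) c ≤ arcValue true t c
arcValue-∨ˡ c≥0 true  t = arcValue-nonneg c≥0 true t
arcValue-∨ˡ c≥0 false t = ℚ.≤-refl

arcValue-submodular : ∀ {c} → 0ℚ ≤ c → ∀ hS hU tS tU →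
  arcValue (hS ∧ hU) (tS ∧ tU) c + arcValue (hS ∨ hU) (tS ∨ tU) c ≤ arcValue hS tS c + arcValue hU tU c
arcValue-submodular {c} c≥0 true  true  true  tU = ℚ.≤-reflexive (ℚ.+-comm (arcValue true tU c) 0ℚ)
arcValue-submodular     c≥0 true  true  false tU = ℚ.≤-refl
arcValue-submodular {c} c≥0 true  false tS    tU = begin
  0ℚ + arcValue true (tS ∨ tU) c  ≡⟨ ℚ.+-identityˡ _ ⟩
  arcValue true (tS ∨ tU) c       ≡⟨ cong (λ t → arcValue true t c) (∨-comm tS tU) ⟩
  arcValue true (tU ∨ tS) c       ≤⟨ arcValue-∨ˡ c≥0 tU tS ⟩
  arcValue true tS c              ≡⟨ ℚ.+-identityʳ _ ⟨
  arcValue true tS c + 0ℚ         ∎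
arcValue-submodular {c} c≥0 false true  tS    tU = ℚ.+-monoʳ-≤ 0ℚ (arcValue-∨ˡ {c} c≥0 tS tU)
arcValue-submodular     c≥0 false false tS    tU = ℚ.≤-refl

lookup-∉ : ∀ {n} {x : Fin n} {S : Subset n} → x ∉ S → lookup S x ≡ false
lookup-∉ x∉S = ¬-not (x∉S ∘ lookup⇒[]= _ _)

entering≡arcValue : ∀ {n} (N : Network n) S e →
  entering N S e ≡ arcValue (lookup S (head N e)) (lookup S (tail N e)) (cap N e)
entering≡arcValue N S e with head N e ∈? S | tail N e ∈? S
... | yes h∈S | yes t∈S rewrite []=⇒lookup h∈S | []=⇒lookup t∈S = refl
... | yes h∈S | no  t∉S rewrite []=⇒lookup h∈S | lookup-∉ t∉S  = refl
... | no  h∉S | _       rewrite lookup-∉ h∉S = refl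

lookup-∩ : ∀ {n} (S U : Subset n) x → lookup (S ∩ U) x ≡ lookup S x ∧ lookup U x
lookup-∩ S U x = lookup-zipWith _∧_ x S U

lookup-∪ : ∀ {n} (S U : Subset n) x → lookup (S ∪ U) x ≡ lookup S x ∨ lookup U x
lookup-∪ S U x = lookup-zipWith _∨_ x S U

module _ {n} (N : Network n) (cap≥0 : ∀ e → 0ℚ ≤ cap N e) where

  cutIn-nonneg : ∀ S → 0ℚ ≤ cutIn N S
  cutIn-nonneg S = sumFin-nonneg (m N) λ e →
    subst (0ℚ ≤_) (sym (entering≡arcValue N S e))
          (arcValue-nonneg (cap≥0 e) (lookup S (head N e)) (lookup S (tail N e)))

  cutIn-submodular : ∀ S U → cutIn N (S ∩ U) + cutIn N (S ∪ U) ≤ cutIn N S + cutIn N U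
  cutIn-submodular S U = begin
    cutIn N (S ∩ U) + cutIn N (S ∪ U)                                 ≡⟨ sumFin-+ (m N) _ _ ⟨
    sumFin (m N) (λ e → entering N (S ∩ U) e + entering N (S ∪ U) e)  ≤⟨ sumFin-mono (m N) perArc ⟩
    sumFin (m N) (λ e → entering N S e + entering N U e)              ≡⟨ sumFin-+ (m N) _ _ ⟩
    cutIn N S + cutIn N U                                             ∎
    where
    perArc : ∀ e → entering N (S ∩ U) e + entering N (S ∪ U) e ≤ entering N S e + entering N U e
    perArc e
      rewrite entering≡arcValue N (S ∩ U) e | entering≡arcValue N (S ∪ U) e
            | entering≡arcValue N S e | entering≡arcValue N U e
            | lookup-∩ S U (head N e) | lookup-∩ S U (tail N e)
            | lookup-∪ S U (head N e) | lookup-∪ S U (tail N e)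
      = arcValue-submodular (cap≥0 e) (lookup S (head N e)) (lookup U (head N e))
                                      (lookup S (tail N e)) (lookup U (tail N e))

  cutIn-∪-subadditive : ∀ S U → cutIn N (S ∪ U) ≤ cutIn N S + cutIn N U
  cutIn-∪-subadditive S U = begin
    cutIn N (S ∪ U)                    ≡⟨ ℚ.+-identityˡ _ ⟨
    0ℚ + cutIn N (S ∪ U)               ≤⟨ ℚ.+-monoˡ-≤ _ (cutIn-nonneg (S ∩ U)) ⟩
    cutIn N (S ∩ U) + cutIn N (S ∪ U)  ≤⟨ cutIn-submodular S U ⟩
    cutIn N S + cutIn N U              ∎

sumOutside : ∀ {n} → Subset n → (Fin n → ℚ) → ℚ
sumOutside {n} X w = sumFin n (λ t → if lookup X t then 0ℚ else w t)

module _ {n} {w : Fin n → ℚ} (w≥0 : ∀ t → 0ℚ ≤ w t) where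

  outsideValue-∪-≤ : ∀ S X t → (if lookup (S ∪ X) t then 0ℚ else w t) ≤ (if lookup X t then 0ℚ else w t)
  outsideValue-∪-≤ S X t rewrite lookup-∪ S X t = arcValue-∨ˡ (w≥0 t) (lookup S t) (lookup X t)

  sumOutside-∪-≤ : ∀ S X → sumOutside (S ∪ X) w ≤ sumOutside X w
  sumOutside-∪-≤ S X = sumFin-mono n (outsideValue-∪-≤ S X)

  sumOutside-∪-gap : ∀ S X {t} → t ∈ S → t ∉ X → sumOutside (S ∪ X) w + w t ≤ sumOutside X w
  sumOutside-∪-gap S X {t} t∈S t∉X = sumFin-mono-gap n (w t) (outsideValue-∪-≤ S X) t gap
    where
    gap : (if lookup (S ∪ X) t then 0ℚ else w t) + w t ≤ (if lookup X t then 0ℚ else w t)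
    gap rewrite lookup-∪ S X t | []=⇒lookup t∈S | lookup-∉ t∉X = ℚ.≤-reflexive (ℚ.+-identityˡ (w t))

lookup-withTstar-inject₁ : ∀ {n} (X : Subset n) i → lookup (withTstar X) (inject₁ i) ≡ lookup X i
lookup-withTstar-inject₁ (b ∷ X) zero    = refl
lookup-withTstar-inject₁ (b ∷ X) (suc i) = lookup-withTstar-inject₁ X i

lookup-withTstar-tstar : ∀ {n} (X : Subset n) → lookup (withTstar X) (tstar n) ≡ true
lookup-withTstar-tstar []      = refl
lookup-withTstar-tstar (b ∷ X) = lookup-withTstar-tstar X

cutIn-flowNetwork : ∀ {n} (G : Network n) T λ' X →
  cutIn (flowNetwork G T λ') (withTstar X) ≡ cutIn G X + sumOutside X (lamCap T λ')
cutIn-flowNetwork {n} G T λ' X =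
  trans (sumFin-↑ (m G) n _) (cong₂ _+_ (sumFin-cong (m G) graphArc) (sumFin-cong n terminalArc))
  where
  F : Network (ℕ.suc n)
  F = flowNetwork G T λ'
  graphArc : ∀ e → entering F (withTstar X) (e ↑ˡ n) ≡ entering G X e
  graphArc e
    rewrite entering≡arcValue F (withTstar X) (e ↑ˡ n) | entering≡arcValue G X e | splitAt-↑ˡ (m G) e n
          | lookup-withTstar-inject₁ X (head G e) | lookup-withTstar-inject₁ X (tail G e)
    = refl
  terminalArc : ∀ t → entering F (withTstar X) (m G ↑ʳ t) ≡ (if lookup X t then 0ℚ else lamCap T λ' t)
  terminalArc t
    rewrite entering≡arcValue F (withTstar X) (m G ↑ʳ t) | splitAt-↑ʳ (m G) n t
          | lookup-withTstar-tstar X | lookup-withTstar-inject₁ X t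
    = refl

∈-withTstar-inject₁⁻ : ∀ {n} (X : Subset n) {i} → inject₁ i ∈ withTstar X → i ∈ X
∈-withTstar-inject₁⁻ X {i} i∈ = lookup⇒[]= i X (trans (sym (lookup-withTstar-inject₁ X i)) ([]=⇒lookup i∈))

tstar∈withTstar : ∀ {n} (X : Subset n) → tstar n ∈ withTstar X
tstar∈withTstar {n} X = lookup⇒[]= (tstar n) (withTstar X) (lookup-withTstar-tstar X)

minFlowCut-bound : ∀ {n} (G : Network n) T λ' {r B} →
  IsMinCut (flowNetwork G T λ') (inject₁ r) (tstar n) (withTstar B) →
  ∀ U → r ∉ U → cutIn G B + sumOutside B (lamCap T λ') ≤ cutIn G U + sumOutside U (lamCap T λ')
minFlowCut-bound G T λ' (_ , minimal) U r∉U =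
  subst₂ _≤_ (cutIn-flowNetwork G T λ' _) (cutIn-flowNetwork G T λ' U)
    (minimal (withTstar U) (r∉U ∘ ∈-withTstar-inject₁⁻ U , tstar∈withTstar U))

subsets : ∀ n → List (Subset n)
subsets ℕ.zero    = [] ∷ []
subsets (ℕ.suc n) = map (outside ∷_) (subsets n) ++ map (inside ∷_) (subsets n)

∈-subsets : ∀ {n} (S : Subset n) → S List.∈ subsets n
∈-subsets []          = here refl
∈-subsets (false ∷ S) = ∈-++⁺ˡ (∈-map⁺ (outside ∷_) (∈-subsets S))
∈-subsets (true  ∷ S) = ∈-++⁺ʳ (map (outside ∷_) (subsets _)) (∈-map⁺ (inside ∷_) (∈-subsets S))

isCutSink? : ∀ {n} (r t : Fin n) → Decidable (IsCutSink r t)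
isCutSink? r t S = ¬? (r ∈? S) ×-dec (t ∈? S)

minCut-exists : ∀ {n} (G : Network n) {r t} S → IsCutSink r t S → Σ (Subset n) (IsMinCut G r t)
minCut-exists {n} G {r} {t} S₀ cut₀ =
  S , argmin-all (cutIn G) cut₀ (all-filter (isCutSink? r t) (subsets n)) , minimal
  where
  cuts : List (Subset n)
  cuts = filter (isCutSink? r t) (subsets n)
  S : Subset n
  S = argmin (cutIn G) S₀ cuts
  minimal : ∀ S' → IsCutSink r t S' → cutIn G S ≤ cutIn G S'
  minimal S' cut' = All.lookup (f[argmin]≤f[xs] S₀ cuts) (∈-filter⁺ (isCutSink? r t) (∈-subsets S') cut')

lamCap-nonneg : ∀ {n} (T : Subset n) {λ'} → 0ℚ ≤ λ' → ∀ t → 0ℚ ≤ lamCap T λ' t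
lamCap-nonneg T λ'≥0 t with t ∈? T
... | yes _ = λ'≥0
... | no  _ = ℚ.≤-refl

lamCap-∈ : ∀ {n} {T : Subset n} {λ' t} → t ∈ T → lamCap T λ' t ≡ λ'
lamCap-∈ {T = T} {t = t} t∈T with t ∈? T
... | yes _   = refl
... | no  t∉T = contradiction t∈T t∉T

module MinFlowCut {n} (G : Network n) (cap≥0 : ∀ e → 0ℚ ≤ cap G e) (T : Subset n) {λ'} (λ'≥0 : 0ℚ ≤ λ')
  {r B} (r∉B : r ∉ B) (minFlowCut : IsMinCut (flowNetwork G T λ') (inject₁ r) (tstar n) (withTstar B))
  where

  private
    c : Subset n → ℚ
    c = cutIn G

    L : Subset n → ℚ
    L X = sumOutside X (lamCap T λ')

    bound : ∀ U → r ∉ U → c B + L B ≤ c U + L U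
    bound = minFlowCut-bound G T λ' minFlowCut

    r∉-∪ : ∀ {S} → r ∉ S → r ∉ S ∪ B
    r∉-∪ {S} r∉S = [ r∉S , r∉B ] ∘ x∈p∪q⁻ S B

  connAtLeast-outside : ∀ t → t ∈ T → t ∉ B → ConnAtLeast G r t λ'
  connAtLeast-outside t t∈T t∉B S (r∉S , t∈S) = +-cancelˡ-≤ (c B + L (S ∪ B)) (begin
    c B + L (S ∪ B) + λ'    ≡⟨ ℚ.+-assoc (c B) _ λ' ⟩
    c B + (L (S ∪ B) + λ')  ≤⟨ ℚ.+-monoʳ-≤ (c B) gap ⟩
    c B + L B               ≤⟨ bound (S ∪ B) (r∉-∪ r∉S) ⟩
    c (S ∪ B) + L (S ∪ B)   ≤⟨ ℚ.+-monoˡ-≤ (L (S ∪ B)) (cutIn-∪-subadditive G cap≥0 S B) ⟩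
    c S + c B + L (S ∪ B)   ≡⟨ xy∙z≈yz∙x (c S) (c B) _ ⟩
    c B + L (S ∪ B) + c S   ∎)
    where
    gap : L (S ∪ B) + λ' ≤ L B
    gap = subst (λ x → L (S ∪ B) + x ≤ L B) (lamCap-∈ t∈T)
            (sumOutside-∪-gap (lamCap-nonneg T λ'≥0) S B t∈S t∉B)

  cutIn-≤-∪ : ∀ S → r ∉ S → c B ≤ c (S ∪ B)
  cutIn-≤-∪ S r∉S = +-cancelʳ-≤ (L (S ∪ B)) (begin
    c B + L (S ∪ B)        ≤⟨ ℚ.+-monoʳ-≤ (c B) (sumOutside-∪-≤ (lamCap-nonneg T λ'≥0) S B) ⟩
    c B + L B              ≤⟨ bound (S ∪ B) (r∉-∪ r∉S) ⟩
    c (S ∪ B) + L (S ∪ B)  ∎)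

  cutIn-∩-≤ : ∀ S → r ∉ S → c (S ∩ B) ≤ c S
  cutIn-∩-≤ S r∉S = +-cancelʳ-≤ (c B) (begin
    c (S ∩ B) + c B        ≤⟨ ℚ.+-monoʳ-≤ (c (S ∩ B)) (cutIn-≤-∪ S r∉S) ⟩
    c (S ∩ B) + c (S ∪ B)  ≤⟨ cutIn-submodular G cap≥0 S B ⟩
    c S + c B              ∎)

  minCut-within : ∀ t → t ∈ B → Σ (Subset n) (λ S → IsMinCut G r t S × S ⊆ B)
  minCut-within t t∈B =
    let S , (r∉S , t∈S) , S-minimal = minCut-exists G B (r∉B , t∈B)
    in  S ∩ B
      , ( (r∉S ∘ proj₁ ∘ x∈p∩q⁻ S B , x∈p∩q⁺ (t∈S , t∈B))
        , λ S' cut' → ℚ.≤-trans (cutIn-∩-≤ S r∉S) (S-minimal S' cut'))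
      , p∩q⊆q S B

mainTheorem3 : ∀ {n} (G : Network n) (r : Fin n) (T : Subset n) (λ' : ℚ) (B : Subset n)
    → (∀ e → 0ℚ ≤ cap G e)
    → r ∉ T
    → 0ℚ < λ'
    → r ∉ B
    → IsMinCut (flowNetwork G T λ') (inject₁ r) (tstar n) (withTstar B)
    → (∀ t → t ∈ T → t ∉ B → ConnAtLeast G r t λ')
      × (∀ t → t ∈ T → t ∈ B → Σ (Subset n) (λ S → IsMinCut G r t S × S ⊆ B))
mainTheorem3 G r T λ' B cap≥0 _ 0<λ' r∉B minFlowCut =
  connAtLeast-outside , (λ t _ → minCut-within t)
  where open MinFlowCut G cap≥0 T (ℚ.<⇒≤ 0<λ') r∉B minFlowCut
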